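{- Let $n,k,t$ be positive integers with $t\ge n$ and $\frac{n(n+1)}{2}=k\cdot t$. Then the last symbol of the run sequence $\rho'(n,k,t)$ of $\Pi\mathit{Solve}(n,k,t)$ is $m$, and $m$ does not occur in $\rho'(n,k,t)$ with its last symbol removed.
   Context: The algorithm $\Pi\mathit{Solve}(n,k,t)$, on an instance $(n,k,t)$ of positive integers with $t\ge n$ and $n(n+1)/2=kt$, tests the following cases in order: case $m$: if $2k\mid n$ or $2k\mid n+1$, it solves the instance directly (meander algorithm) and stops; case $s$: else if $t\ge 2n$, it recurses on $(n-2k,\ k,\ t-2(n-k)-1)$; case $ge$: else if $t<2n$ and $t$ even, it recurses on $(t-n-1,\ 2(k-n)+t-1,\ t/2)$; case $go$: else ($t<2n$, $t$ odd) it recurses on $(t-n-1,\ k-\frac{2n-t+1}{2},\ t)$. The run sequence $\rho'(n,k,t)\in\{m,s,ge,go\}^+$ is the sequence of case symbols of the successive calls, starting with the call on $(n,k,t)$. -}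

module Defs where

open import Data.Integer using (ℤ; +_; _+_; _-_; _*_; _≤_; _<_)
open import Data.Integer.Divisibility using (_∣_)
open import Data.List using (List; []; _∷_)
open import Data.Product using (_×_)
open import Data.Sum using (_⊎_)
open import Relation.Nullary using (¬_)
open import Relation.Binary.PropositionalEquality using (_≡_)

data Sym : Set where
  m s ge go : Sym

MCond : ℤ → ℤ → Set
MCond n k = ((+ 2) * k ∣ n) ⊎ ((+ 2) * k ∣ n + + 1)

-- Run n k t ρ : the call ΠSolve(n,k,t) terminates and its run sequence is ρ.
-- Arithmetic is over ℤ so that no truncated subtraction occurs.
-- t/2 (case ge, t even) is represented by h with t = 2h;
-- (2n-t+1)/2 (case go, t odd) is represented by d with 2n-t+1 = 2d.
data Run : ℤ → ℤ → ℤ → List Sym → Set where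
  case-m  : ∀ {n k t} → MCond n k → Run n k t (m ∷ [])
  case-s  : ∀ {n k t ρ} → ¬ MCond n k → (+ 2) * n ≤ t →
            Run (n - (+ 2) * k) k (t - (+ 2) * (n - k) - + 1) ρ →
            Run n k t (s ∷ ρ)
  case-ge : ∀ {n k t h ρ} → ¬ MCond n k → t < (+ 2) * n → t ≡ (+ 2) * h →
            Run (t - n - + 1) ((+ 2) * (k - n) + t - + 1) h ρ →
            Run n k t (ge ∷ ρ)
  case-go : ∀ {n k t d ρ} → ¬ MCond n k → t < (+ 2) * n → ¬ ((+ 2) ∣ t) →
            (+ 2) * n - t + + 1 ≡ (+ 2) * d →
            Run (t - n - + 1) (k - d) t ρ →
            Run n k t (go ∷ ρ)

module Submission where

-- Call (n,k,t) an *instance* when n, k ≥ 1, n ≤ t and n(n+1) = 2kt (over ℤ).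
-- Case m is a stop and its test fails in every other case, so the run
-- sequence has the shape xs ∷ʳ m with m ∉ xs as soon as every call terminates.
-- Termination follows from a descent argument: each of the recursive cases
-- s, ge and go maps an instance to an instance with a strictly smaller n.
--   * case s  (2n ≤ t): n(n+1-4k) = 2k(t-2n) ≥ 0 gives 4k ≤ n+1, which keeps
--     n-2k positive and below the new t; the balance n(n+1) = 2kt is preserved
--     by a ring identity.
--   * cases ge, go (t < 2n): the new n is t-n-1 < n; it is positive because
--     t ∈ {n, n+1} would force 2k = n+1 or 2k = n, i.e. case m; positivity of
--     the new k is read off the preserved balance equation.

module Descent where
  open import Defs
  open import Data.Empty using (⊥-elim)
  open import Data.Integer
    using (ℤ; +_; -[1+_]; +[1+_]; _+_; _-_; _*_; _≤_; _<_; +≤+)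
  open import Data.Integer.Properties
    using ( ≤-trans; <-≤-trans; _≤?_; ≰⇒>; +-mono-≤; +-inverseʳ; +-identityʳ
          ; i≤j⇒0≤j-i; 0≤i-j⇒j≤i; suc[i]≤j⇒i<j; i<j⇒suc[i]≤j; i<j⇒i≤pred[j]
          ; i-j≡0⇒i≡j; *-cancelˡ-≡; *-zeroʳ )
  import Data.Integer.Properties as ℤₚ
  open import Data.Integer.Divisibility using (_∣_)
  open import Data.Integer.Tactic.RingSolver using (solve-∀)
  open import Data.List using (List; []; _∷_; _∷ʳ_)
  open import Data.List.Membership.Propositional using (_∉_)
  open import Data.List.Relation.Unary.Any using (here; there)
  open import Data.Product using (Σ; _×_; _,_)
  open import Data.Sum using (_⊎_; inj₁; inj₂)
  open import Relation.Binary.PropositionalEquality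
    using (_≡_; _≢_; refl; sym; trans; cong; subst; module ≡-Reasoning)
  open import Relation.Nullary using (¬_; Dec; yes; no)
  open import Relation.Nullary.Decidable using (_⊎-dec_)
  import Data.Nat as ℕ
  import Data.Nat.Properties as ℕₚ
  import Data.Nat.Divisibility as ℕ∣

  -- Sign rules for integer sums and products.  Every inequality below is read
  -- off a ring identity whose right-hand side is visibly nonnegative by them.
  nonneg-+ : ∀ {a b} → + 0 ≤ a → + 0 ≤ b → + 0 ≤ a + b
  nonneg-+ = +-mono-≤

  nat-nonneg : ∀ x → + 0 ≤ + x
  nat-nonneg _ = +≤+ ℕ.z≤n

  nonneg-* : ∀ {a b} → + 0 ≤ a → + 0 ≤ b → + 0 ≤ a * b
  nonneg-* {+ a} {+ b} _ _ = subst (+ 0 ≤_) (ℤₚ.pos-* a b) (nat-nonneg (a ℕ.* b))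

  pos⇒nonneg : ∀ {a} → + 1 ≤ a → + 0 ≤ a
  pos⇒nonneg = ≤-trans (nat-nonneg 1)

  pos-* : ∀ {a b} → + 1 ≤ a → + 1 ≤ b → + 1 ≤ a * b
  pos-* (+≤+ (ℕ.s≤s _)) (+≤+ (ℕ.s≤s _)) = +≤+ (ℕ.s≤s ℕ.z≤n)

  pos-suc : ∀ {a} → + 1 ≤ a → + 1 ≤ a + + 1
  pos-suc (+≤+ (ℕ.s≤s _)) = +≤+ (ℕ.s≤s ℕ.z≤n)

  two-pos : + 1 ≤ + 2
  two-pos = +≤+ (ℕ.s≤s ℕ.z≤n)

  nonneg-cancelˡ : ∀ {c x} → + 1 ≤ c → + 0 ≤ c * x → + 0 ≤ x
  nonneg-cancelˡ {x = + x} _ _ = nat-nonneg x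
  nonneg-cancelˡ {x = -[1+ _ ]} (+≤+ (ℕ.s≤s _)) ()

  pos-cancelˡ : ∀ {c x} → + 1 ≤ c → + 1 ≤ c * x → + 1 ≤ x
  pos-cancelˡ {x = +[1+ _ ]} _ _ = +≤+ (ℕ.s≤s ℕ.z≤n)
  pos-cancelˡ {c} {+ 0} _ c*0≥1 with +≤+ () ← subst (+ 1 ≤_) (*-zeroʳ c) c*0≥1
  pos-cancelˡ {x = -[1+ _ ]} (+≤+ (ℕ.s≤s _)) ()

  cancel-pos : ∀ {c a b} → + 1 ≤ c → c * a ≡ c * b → a ≡ b
  cancel-pos {+[1+ c ]} {a} {b} _ = *-cancelˡ-≡ +[1+ c ] a b
  cancel-pos {+ 0} (+≤+ ())

  ≤-by-difference : ∀ {a b} c → b - a ≡ c → + 0 ≤ c → a ≤ b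
  ≤-by-difference c b-a≡c c≥0 = 0≤i-j⇒j≤i (subst (+ 0 ≤_) (sym b-a≡c) c≥0)

  -- Adding a difference of equal quantities changes nothing: this is how a
  -- ring identity  lhs ≡ x + (a - b)  yields  lhs ≡ x  under the hypothesis a ≡ b.
  +-vanishing : ∀ x {a b} → a ≡ b → x + (a - b) ≡ x
  +-vanishing x {a} refl = trans (cong (λ u → x + u) (+-inverseʳ a)) (+-identityʳ x)

  record Instance (n k t : ℤ) : Set where
    field
      n-pos    : + 1 ≤ n
      k-pos    : + 1 ≤ k
      n≤t      : n ≤ t
      balanced : n * (n + + 1) ≡ + 2 * k * t

  open Instance

  step-s : ∀ {n k t} → Instance n k t → + 2 * n ≤ t →
           Instance (n - + 2 * k) k (t - + 2 * (n - k) - + 1) × n - + 2 * k < n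
  step-s {n} {k} {t} I 2n≤t =
    record { n-pos = n′-pos ; k-pos = k-pos I ; n≤t = n′≤t′ ; balanced = balanced′ } , n′<n
    where
    n′ t′ slack : ℤ
    n′ = n - + 2 * k
    t′ = t - + 2 * (n - k) - + 1
    slack = n + + 1 - + 4 * k

    slack-identity : ∀ n k t →
      n * (n + + 1 - + 4 * k) ≡ + 2 * k * (t - + 2 * n) + (n * (n + + 1) - + 2 * k * t)
    slack-identity = solve-∀
    n′-identity : ∀ n k → n - + 2 * k - + 1 ≡ (n + + 1 - + 4 * k) + + 2 * (k - + 1)
    n′-identity = solve-∀
    decrease-identity : ∀ n k → n - (+ 1 + (n - + 2 * k)) ≡ + 2 * (k - + 1) + + 1
    decrease-identity = solve-∀
    gap-identity : ∀ n k t →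
      + 2 * k * ((t - + 2 * (n - k) - + 1) - (n - + 2 * k))
        ≡ (n - + 2 * k) * (n + + 1 - + 4 * k) + (+ 2 * k * t - n * (n + + 1))
    gap-identity = solve-∀
    balance-identity : ∀ n k t →
      (n - + 2 * k) * ((n - + 2 * k) + + 1)
        ≡ + 2 * k * (t - + 2 * (n - k) - + 1) + (n * (n + + 1) - + 2 * k * t)
    balance-identity = solve-∀

    k-1≥0 : + 0 ≤ k - + 1
    k-1≥0 = i≤j⇒0≤j-i (k-pos I)

    -- n · slack = 2k(t - 2n) ≥ 0, hence 4k ≤ n + 1.
    slack≥0 : + 0 ≤ slack
    slack≥0 = nonneg-cancelˡ (n-pos I)
      (subst (+ 0 ≤_) (sym (trans (slack-identity n k t) (+-vanishing _ (balanced I))))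
             (nonneg-* (nonneg-* (nat-nonneg 2) (pos⇒nonneg (k-pos I))) (i≤j⇒0≤j-i 2n≤t)))

    n′-pos : + 1 ≤ n′
    n′-pos = ≤-by-difference _ (n′-identity n k)
               (nonneg-+ slack≥0 (nonneg-* (nat-nonneg 2) k-1≥0))

    n′<n : n′ < n
    n′<n = suc[i]≤j⇒i<j (≤-by-difference _ (decrease-identity n k)
             (nonneg-+ (nonneg-* (nat-nonneg 2) k-1≥0) (nat-nonneg 1)))

    -- 2k (t′ - n′) = n′ · slack ≥ 0.
    n′≤t′ : n′ ≤ t′
    n′≤t′ = 0≤i-j⇒j≤i (nonneg-cancelˡ (pos-* two-pos (k-pos I))
      (subst (+ 0 ≤_) (sym (trans (gap-identity n k t) (+-vanishing _ (sym (balanced I)))))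
             (nonneg-* (pos⇒nonneg n′-pos) slack≥0)))

    balanced′ : n′ * (n′ + + 1) ≡ + 2 * k * t′
    balanced′ = trans (balance-identity n k t) (+-vanishing _ (balanced I))

  reflect-smaller : ∀ {n t} → t < + 2 * n → t - n - + 1 < n
  reflect-smaller {n} {t} t<2n = suc[i]≤j⇒i<j (≤-by-difference _ (reflect-identity n t)
    (nonneg-+ (i≤j⇒0≤j-i (i<j⇒suc[i]≤j t<2n)) (nat-nonneg 1)))
    where
    reflect-identity : ∀ n t → n - (+ 1 + (t - n - + 1)) ≡ (+ 2 * n - (+ 1 + t)) + + 1
    reflect-identity = solve-∀

  divides-self : ∀ {a b} → a ≡ b → b ∣ a
  divides-self refl = ℕ∣.∣-refl

  diagonal-is-m : ∀ {n k} → + 1 ≤ n → n * (n + + 1) ≡ + 2 * k * n → MCond n k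
  diagonal-is-m {n} {k} n≥1 eq = inj₂ (divides-self {n + + 1} (cancel-pos n≥1 (trans eq (swap n k))))
    where
    swap : ∀ n k → + 2 * k * n ≡ n * (+ 2 * k)
    swap = solve-∀

  subdiagonal-is-m : ∀ {n k} → + 1 ≤ n → n * (n + + 1) ≡ + 2 * k * (n + + 1) → MCond n k
  subdiagonal-is-m {n} {k} n≥1 eq =
    inj₁ (divides-self {n} (cancel-pos (pos-suc n≥1) (trans (swapˡ n) (trans eq (swapʳ n k)))))
    where
    swapˡ : ∀ n → (n + + 1) * n ≡ n * (n + + 1)
    swapˡ = solve-∀
    swapʳ : ∀ n k → + 2 * k * (n + + 1) ≡ (n + + 1) * (+ 2 * k)
    swapʳ = solve-∀

  reflect-pos : ∀ {n k t} → Instance n k t → ¬ MCond n k → + 1 ≤ t - n - + 1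
  reflect-pos {n} {k} {t} I ¬mc with t - n in t-n≡ | i≤j⇒0≤j-i (n≤t I)
  ... | + 0 | _ = ⊥-elim (¬mc (diagonal-is-m {n} {k} (n-pos I)
                    (subst (λ u → n * (n + + 1) ≡ + 2 * k * u) t≡n (balanced I))))
    where
    t≡n : t ≡ n
    t≡n = i-j≡0⇒i≡j t n t-n≡
  ... | + 1 | _ = ⊥-elim (¬mc (subdiagonal-is-m {n} {k} (n-pos I)
                    (subst (λ u → n * (n + + 1) ≡ + 2 * k * u) t≡n+1 (balanced I))))
    where
    split : ∀ t n → t ≡ n + (t - n)
    split = solve-∀
    t≡n+1 : t ≡ n + + 1
    t≡n+1 = trans (split t n) (cong (λ u → n + u) t-n≡)
  ... | +[1+ ℕ.suc _ ] | _ = +≤+ (ℕ.s≤s ℕ.z≤n)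

  multiplier-pos : ∀ {x y c} → + 1 ≤ x → + 1 ≤ c → x * (x + + 1) ≡ + 2 * y * c → + 1 ≤ y
  multiplier-pos {x} {y} {c} x≥1 c≥1 eq =
    pos-cancelˡ (pos-* two-pos c≥1) (subst (+ 1 ≤_) (trans eq (regroup y c)) (pos-* x≥1 (pos-suc x≥1)))
    where
    regroup : ∀ y c → + 2 * y * c ≡ + 2 * c * y
    regroup = solve-∀

  step-ge : ∀ {n k h} → Instance n k (+ 2 * h) → ¬ MCond n k → + 2 * h < + 2 * n →
            Instance (+ 2 * h - n - + 1) (+ 2 * (k - n) + + 2 * h - + 1) h × + 2 * h - n - + 1 < n
  step-ge {n} {k} {h} I ¬mc t<2n =
    record { n-pos = n′-pos ; k-pos = k′-pos ; n≤t = n′≤h ; balanced = balanced′ } , reflect-smaller t<2n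
    where
    n′ k′ : ℤ
    n′ = + 2 * h - n - + 1
    k′ = + 2 * (k - n) + + 2 * h - + 1

    balance-identity : ∀ n k h →
      (+ 2 * h - n - + 1) * ((+ 2 * h - n - + 1) + + 1)
        ≡ + 2 * (+ 2 * (k - n) + + 2 * h - + 1) * h + (n * (n + + 1) - + 2 * k * (+ 2 * h))
    balance-identity = solve-∀
    half-identity : ∀ n h → + 2 * (h - (+ 2 * h - n - + 1)) ≡ (+ 2 * n - (+ 1 + + 2 * h)) + + 3
    half-identity = solve-∀

    n′-pos : + 1 ≤ n′
    n′-pos = reflect-pos I ¬mc

    balanced′ : n′ * (n′ + + 1) ≡ + 2 * k′ * h
    balanced′ = trans (balance-identity n k h) (+-vanishing _ (balanced I))

    h-pos : + 1 ≤ h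
    h-pos = pos-cancelˡ two-pos (≤-trans (n-pos I) (n≤t I))

    k′-pos : + 1 ≤ k′
    k′-pos = multiplier-pos n′-pos h-pos balanced′

    -- 2(h - n′) = (2n - (2h + 1)) + 3 ≥ 0.
    n′≤h : n′ ≤ h
    n′≤h = 0≤i-j⇒j≤i (nonneg-cancelˡ two-pos (subst (+ 0 ≤_) (sym (half-identity n h))
             (nonneg-+ (i≤j⇒0≤j-i (i<j⇒suc[i]≤j t<2n)) (nat-nonneg 3))))

  step-go : ∀ {n k t d} → Instance n k t → ¬ MCond n k → t < + 2 * n →
            + 2 * n - t + + 1 ≡ + 2 * d →
            Instance (t - n - + 1) (k - d) t × t - n - + 1 < n
  step-go {n} {k} {t} {d} I ¬mc t<2n d-eq =
    record { n-pos = n′-pos ; k-pos = k′-pos ; n≤t = n′≤t ; balanced = balanced′ } , reflect-smaller t<2n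
    where
    n′ : ℤ
    n′ = t - n - + 1

    balance-identity : ∀ n k t d →
      (t - n - + 1) * ((t - n - + 1) + + 1)
        ≡ + 2 * (k - d) * t + (n * (n + + 1) - + 2 * k * t)
            + (t * (+ 2 * d) - t * (+ 2 * n - t + + 1))
    balance-identity = solve-∀
    gap-identity : ∀ n t → t - (t - n - + 1) ≡ n + + 1
    gap-identity = solve-∀

    n′-pos : + 1 ≤ n′
    n′-pos = reflect-pos I ¬mc

    balanced′ : n′ * (n′ + + 1) ≡ + 2 * (k - d) * t
    balanced′ = begin
      n′ * (n′ + + 1)
        ≡⟨ balance-identity n k t d ⟩
      + 2 * (k - d) * t + (n * (n + + 1) - + 2 * k * t) + (t * (+ 2 * d) - t * (+ 2 * n - t + + 1))
        ≡⟨ +-vanishing _ (cong (t *_) (sym d-eq)) ⟩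
      + 2 * (k - d) * t + (n * (n + + 1) - + 2 * k * t)
        ≡⟨ +-vanishing _ (balanced I) ⟩
      + 2 * (k - d) * t ∎
      where open ≡-Reasoning

    k′-pos : + 1 ≤ k - d
    k′-pos = multiplier-pos n′-pos (≤-trans (n-pos I) (n≤t I)) balanced′

    n′≤t : n′ ≤ t
    n′≤t = ≤-by-difference _ (gap-identity n t) (pos⇒nonneg (pos-suc (n-pos I)))

  parity : ∀ x → 2 ℕ∣.∣ x ⊎ 2 ℕ∣.∣ ℕ.suc x
  parity ℕ.zero    = inj₁ (2 ℕ∣.∣0)
  parity (ℕ.suc x) with parity x
  ... | inj₁ 2∣x  = inj₂ (ℕ∣.∣m∣n⇒∣m+n ℕ∣.∣-refl 2∣x)
  ... | inj₂ 2∣1+x = inj₁ 2∣1+x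

  halve : ∀ {y} → 2 ℕ∣.∣ y → Σ ℤ λ h → + y ≡ + 2 * h
  halve 2∣y = + ℕ∣.quotient 2∣y ,
    trans (cong +_ (ℕ∣.m∣n⇒n≡m*quotient 2∣y)) (ℤₚ.pos-* 2 (ℕ∣.quotient 2∣y))

  even-or-odd : ∀ t → + 0 ≤ t →
                Σ ℤ (λ h → t ≡ + 2 * h) ⊎ (¬ (+ 2 ∣ t) × Σ ℤ λ q → + 1 + t ≡ + 2 * q)
  even-or-odd -[1+ _ ] ()
  even-or-odd (+ x) _ with 2 ℕ∣.∣? x
  ... | yes 2∣x = inj₁ (halve 2∣x)
  ... | no 2∤x with parity x
  ...   | inj₁ 2∣x   = ⊥-elim (2∤x 2∣x)
  ...   | inj₂ 2∣1+x = inj₂ (2∤x , halve 2∣1+x)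

  odd-defect : ∀ {n t q} → + 1 + t ≡ + 2 * q → + 2 * n - t + + 1 ≡ + 2 * (n - q + + 1)
  odd-defect {n} {t} {q} 1+t≡2q = trans (identity n t q) (+-vanishing _ (sym 1+t≡2q))
    where
    identity : ∀ n t q → + 2 * n - t + + 1 ≡ + 2 * (n - q + + 1) + (+ 2 * q - (+ 1 + t))
    identity = solve-∀

  mcond? : ∀ n k → Dec (MCond n k)
  mcond? n k = (_ ℕ∣.∣? _) ⊎-dec (_ ℕ∣.∣? _)

  Solution : ℤ → ℤ → ℤ → Set
  Solution n k t = Σ (List Sym) λ xs → Run n k t (xs ∷ʳ m) × m ∉ xs

  prepend : ∀ {n k t n′ k′ t′} (σ : Sym) → σ ≢ m →
            (∀ {ρ} → Run n′ k′ t′ ρ → Run n k t (σ ∷ ρ)) →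
            Solution n′ k′ t′ → Solution n k t
  prepend σ σ≢m extend (xs , run , m∉xs) =
    σ ∷ xs , extend run , λ { (here m≡σ) → σ≢m (sym m≡σ) ; (there m∈xs) → m∉xs m∈xs }

  mutual
    solve : ∀ fuel {n k t} → n ≤ + fuel → Instance n k t → Solution n k t
    solve ℕ.zero n≤0 I with +≤+ () ← ≤-trans (n-pos I) n≤0
    solve (ℕ.suc g) {n} {k} {t} n≤ I with mcond? n k
    ... | yes mc = [] , case-m mc , λ ()
    ... | no ¬mc with + 2 * n ≤? t
    ...   | yes 2n≤t = prepend s (λ ()) (case-s ¬mc 2n≤t) (descend g n≤ (step-s I 2n≤t))
    ...   | no 2n≰t with even-or-odd t (≤-trans (pos⇒nonneg (n-pos I)) (n≤t I))
    ...     | inj₁ (h , refl) =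
                prepend ge (λ ()) (case-ge ¬mc (≰⇒> 2n≰t) refl)
                        (descend g n≤ (step-ge I ¬mc (≰⇒> 2n≰t)))
    ...     | inj₂ (t-odd , q , 1+t≡2q) =
                prepend go (λ ()) (case-go ¬mc (≰⇒> 2n≰t) t-odd (odd-defect {n} 1+t≡2q))
                        (descend g n≤ (step-go I ¬mc (≰⇒> 2n≰t) (odd-defect {n} 1+t≡2q)))

    descend : ∀ g {n n′ k′ t′} → n ≤ + ℕ.suc g → Instance n′ k′ t′ × n′ < n → Solution n′ k′ t′
    descend g n≤ (I′ , n′<n) = solve g (i<j⇒i≤pred[j] (<-≤-trans n′<n n≤)) I′

  -- n(n+1) is even, so the hypothesis (n(n+1))/2 = kt says n(n+1) = 2kt.
  consecutive-even : ∀ n → 2 ℕ∣.∣ n ℕ.* ℕ.suc n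
  consecutive-even n with parity n
  ... | inj₁ 2∣n   = ℕ∣.∣m⇒∣m*n (ℕ.suc n) 2∣n
  ... | inj₂ 2∣1+n = ℕ∣.∣n⇒∣m*n n 2∣1+n

  balanced-from-halved : ∀ n k t → (n ℕ.* ℕ.suc n) ℕ./ 2 ≡ k ℕ.* t →
                         + n * (+ n + + 1) ≡ + 2 * + k * + t
  balanced-from-halved n k t halved = begin
    + n * (+ n + + 1)         ≡⟨ sym (ℤₚ.pos-* n (n ℕ.+ 1)) ⟩
    + (n ℕ.* (n ℕ.+ 1))       ≡⟨ cong (λ u → + (n ℕ.* u)) (ℕₚ.+-comm n 1) ⟩
    + (n ℕ.* ℕ.suc n)         ≡⟨ cong +_ doubled ⟩
    + (2 ℕ.* (k ℕ.* t))       ≡⟨ ℤₚ.pos-* 2 (k ℕ.* t) ⟩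
    + 2 * + (k ℕ.* t)         ≡⟨ cong (+ 2 *_) (ℤₚ.pos-* k t) ⟩
    + 2 * (+ k * + t)         ≡⟨ sym (ℤₚ.*-assoc (+ 2) (+ k) (+ t)) ⟩
    + 2 * + k * + t           ∎
    where
    open ≡-Reasoning
    even = consecutive-even n
    doubled : n ℕ.* ℕ.suc n ≡ 2 ℕ.* (k ℕ.* t)
    doubled = trans (ℕ∣.m∣n⇒n≡m*quotient even)
                    (cong (2 ℕ.*_) (trans (sym (ℕ∣.n/m≡quotient even)) halved))

open import Defs
open import Data.Nat using (ℕ; _*_; _≤_; suc; _/_)
open import Data.Integer using (+_)
open import Data.List using (List; _∷ʳ_)
open import Data.List.Membership.Propositional using (_∉_)
open import Data.Product using (Σ; _×_)
open import Relation.Binary.PropositionalEquality using (_≡_)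

open import Data.Nat.Properties using (≤-refl)
open import Data.Integer using (+≤+)
open Descent using (solve; balanced-from-halved)

lemma5 : (n k t : ℕ) → 1 ≤ n → 1 ≤ k → 1 ≤ t → n ≤ t →
    (n * suc n) / 2 ≡ k * t →
    Σ (List Sym) λ xs → Run (+ n) (+ k) (+ t) (xs ∷ʳ m) × m ∉ xs
lemma5 n k t n≥1 k≥1 _ n≤t halved = solve n (+≤+ ≤-refl) record
  { n-pos    = +≤+ n≥1
  ; k-pos    = +≤+ k≥1
  ; n≤t      = +≤+ n≤t
  ; balanced = balanced-from-halved n k t halved
  }
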